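{- Let $\langle B,f\rangle$ be a closure algebra and let $F$ be a filter of $B$ with $F\neq\{1\}$ such that the set of closed elements of $f$ is $\{0\}\cup F$. Then $F$ is a principal filter.
   Context: $B$ is a Boolean algebra. A closure algebra is a pair $\langle B,f\rangle$ with $f:B\to B$ satisfying $f(0)=0$, $f(a+b)=f(a)+f(b)$, $a\le f(a)$ and $f(f(a))=f(a)$ for all $a,b\in B$. An element $x$ is closed if $f(x)=x$. -}

module Defs where

open import Level using (Level; _⊔_; suc)
open import Algebra.Lattice.Bundles using (BooleanAlgebra)
open import Data.Product using (Σ; _×_; _,_)
open import Data.Sum using (_⊎_)
open import Relation.Nullary using (¬_)
open import Function.Bundles using (_⇔_)

module _ {c ℓ : Level} (B : BooleanAlgebra c ℓ) where
  open BooleanAlgebra B renaming (¬_ to ∁_)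

  _≤_ : Carrier → Carrier → Set ℓ
  a ≤ b = (a ∧ b) ≈ a

  record IsClosureOperator (f : Carrier → Carrier) : Set (c ⊔ ℓ) where
    field
      cong         : ∀ {a b} → a ≈ b → f a ≈ f b
      f-⊥          : f ⊥ ≈ ⊥
      f-∨          : ∀ a b → f (a ∨ b) ≈ (f a ∨ f b)
      extensive    : ∀ a → a ≤ f a
      idempotent   : ∀ a → f (f a) ≈ f a

  IsClosed : (Carrier → Carrier) → Carrier → Set ℓ
  IsClosed f x = f x ≈ x

  record IsFilter {p : Level} (F : Carrier → Set p) : Set (c ⊔ ℓ ⊔ p) where
    field
      resp     : ∀ {a b} → a ≈ b → F a → F b
      has-⊤    : F ⊤
      up       : ∀ {a b} → a ≤ b → F a → F b
      meet     : ∀ {a b} → F a → F b → F (a ∧ b)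

  IsPrincipal : {p : Level} → (Carrier → Set p) → Set (c ⊔ ℓ ⊔ p)
  IsPrincipal F = Σ Carrier λ a → ∀ x → (F x ⇔ (a ≤ x))

  NotTrivial : {p : Level} → (Carrier → Set p) → Set (c ⊔ ℓ ⊔ p)
  NotTrivial F = Σ Carrier λ x → F x × ¬ (x ≈ ⊤)

  ClosedSetIs⊥∪ : {p : Level} → (Carrier → Carrier) → (Carrier → Set p) → Set (c ⊔ ℓ ⊔ p)
  ClosedSetIs⊥∪ f F = ∀ x → (IsClosed f x ⇔ ((x ≈ ⊥) ⊎ F x))

-- If x ∈ F is not ⊤, then f (∁ x) is closed and, lying above ∁ x ≠ ⊥, nonzero; so it belongs
-- to F, and so does a = x ∧ f (∁ x). For y ∈ F the element ∁ x ∨ y is in F, hence closed, and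
-- it lies above ∁ x, hence above f (∁ x). Therefore a ≤ x ∧ (∁ x ∨ y) = x ∧ y ≤ y, i.e. F = ↑a.
{-# OPTIONS --safe #-}
module Submission where

open import Defs
open import Level using (Level)
open import Algebra.Lattice.Bundles using (BooleanAlgebra)
open import Data.Product using (_,_)
open import Data.Sum using (inj₁; inj₂)
open import Function.Bundles using (mk⇔; Equivalence)
open import Relation.Nullary using (¬_; contradiction)
import Algebra.Lattice.Properties.BooleanAlgebra as BooleanAlgebraProperties
import Algebra.Lattice.Properties.Lattice as LatticeProperties
import Relation.Binary.Lattice as OrderTheoretic
import Relation.Binary.Lattice.Properties.MeetSemilattice as MeetSemilatticeProperties
import Relation.Binary.Lattice.Properties.JoinSemilattice as JoinSemilatticeProperties
import Relation.Binary.Reasoning.Setoid as SetoidReasoning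

module BooleanAlgebraOrder {c ℓ : Level} (B : BooleanAlgebra c ℓ) where
  open BooleanAlgebra B renaming (¬_ to ∁_)
  open BooleanAlgebraProperties B using (∧-zeroʳ; ∨-identityˡ; ¬⊥≈⊤; ¬-involutive)
  open SetoidReasoning setoid

  -- The standard library orders a lattice by x ≈ x ∧ y, the symmetric form of _≤_ B.
  private
    module O = OrderTheoretic.Lattice (LatticeProperties.∨-∧-orderTheoreticLattice lattice)
    open MeetSemilatticeProperties O.meetSemilattice using (∧-monotonic)
    open JoinSemilatticeProperties O.joinSemilattice using (x≤y⇒x∨y≈y)

  ≤-trans : ∀ {a b d} → _≤_ B a b → _≤_ B b d → _≤_ B a d
  ≤-trans a≤b b≤d = sym (O.trans (sym a≤b) (sym b≤d))

  ≤-respʳ-≈ : ∀ {a b d} → b ≈ d → _≤_ B a b → _≤_ B a d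
  ≤-respʳ-≈ b≈d a≤b = sym (O.≤-respʳ-≈ b≈d (sym a≤b))

  ≤-respˡ-≈ : ∀ {a b d} → a ≈ b → _≤_ B a d → _≤_ B b d
  ≤-respˡ-≈ a≈b a≤d = sym (O.≤-respˡ-≈ a≈b (sym a≤d))

  x≤x∨y : ∀ x y → _≤_ B x (x ∨ y)
  x≤x∨y x y = sym (O.x≤x∨y x y)

  y≤x∨y : ∀ x y → _≤_ B y (x ∨ y)
  y≤x∨y x y = sym (O.y≤x∨y x y)

  x∧y≤y : ∀ x y → _≤_ B (x ∧ y) y
  x∧y≤y x y = sym (O.x∧y≤y x y)

  ∧-monotoneʳ : ∀ x {a b} → _≤_ B a b → _≤_ B (x ∧ a) (x ∧ b)
  ∧-monotoneʳ x a≤b = sym (∧-monotonic (O.refl {x}) (sym a≤b))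

  ≤⇒∨≈ : ∀ {a b} → _≤_ B a b → a ∨ b ≈ b
  ≤⇒∨≈ a≤b = x≤y⇒x∨y≈y (sym a≤b)

  ∨≈⇒≤ : ∀ {a b} → a ∨ b ≈ b → _≤_ B a b
  ∨≈⇒≤ a∨b≈b = ≤-respʳ-≈ a∨b≈b (x≤x∨y _ _)

  ≤⊥⇒≈⊥ : ∀ {a} → _≤_ B a ⊥ → a ≈ ⊥
  ≤⊥⇒≈⊥ {a} a≤⊥ = trans (sym a≤⊥) (∧-zeroʳ a)

  ∁≈⊥⇒≈⊤ : ∀ {x} → ∁ x ≈ ⊥ → x ≈ ⊤
  ∁≈⊥⇒≈⊤ {x} ∁x≈⊥ = begin
    x       ≈⟨ sym (¬-involutive x) ⟩
    ∁ (∁ x) ≈⟨ ¬-cong ∁x≈⊥ ⟩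
    ∁ ⊥     ≈⟨ ¬⊥≈⊤ ⟩
    ⊤       ∎

  ∧-∁∨-cancel : ∀ x y → x ∧ (∁ x ∨ y) ≈ x ∧ y
  ∧-∁∨-cancel x y = begin
    x ∧ (∁ x ∨ y)         ≈⟨ ∧-distribˡ-∨ x (∁ x) y ⟩
    (x ∧ ∁ x) ∨ (x ∧ y)   ≈⟨ ∨-congʳ (∧-complementʳ x) ⟩
    ⊥ ∨ (x ∧ y)           ≈⟨ ∨-identityˡ (x ∧ y) ⟩
    x ∧ y                 ∎

module ClosureOperatorProperties {c ℓ : Level} {B : BooleanAlgebra c ℓ}
    {f : BooleanAlgebra.Carrier B → BooleanAlgebra.Carrier B}
    (isClosure : IsClosureOperator B f) where
  open BooleanAlgebra B
  open IsClosureOperator isClosure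
  open BooleanAlgebraOrder B

  f-monotone : ∀ {a b} → _≤_ B a b → _≤_ B (f a) (f b)
  f-monotone a≤b = ∨≈⇒≤ (trans (sym (f-∨ _ _)) (cong (≤⇒∨≈ a≤b)))

  f-least : ∀ {a x} → IsClosed B f x → _≤_ B a x → _≤_ B (f a) x
  f-least fx≈x a≤x = ≤-respʳ-≈ fx≈x (f-monotone a≤x)

  f≈⊥⇒≈⊥ : ∀ {a} → f a ≈ ⊥ → a ≈ ⊥
  f≈⊥⇒≈⊥ {a} fa≈⊥ = ≤⊥⇒≈⊥ (≤-respʳ-≈ fa≈⊥ (extensive a))

module ClosedFilter {c ℓ p : Level} {B : BooleanAlgebra c ℓ}
    {f : BooleanAlgebra.Carrier B → BooleanAlgebra.Carrier B}
    {F : BooleanAlgebra.Carrier B → Set p}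
    (isClosure : IsClosureOperator B f) (isFilter : IsFilter B F) where
  open BooleanAlgebra B renaming (¬_ to ∁_)
  open IsClosureOperator isClosure using (idempotent)
  open IsFilter isFilter
  open BooleanAlgebraOrder B
  open ClosureOperatorProperties isClosure

  f∁∈F : (∀ {x} → IsClosed B f x → ¬ x ≈ ⊥ → F x) →
         ∀ {x} → ¬ x ≈ ⊤ → F (f (∁ x))
  f∁∈F closed⇒∈F x≉⊤ =
    closed⇒∈F (idempotent _) (λ f∁x≈⊥ → x≉⊤ (∁≈⊥⇒≈⊤ (f≈⊥⇒≈⊥ f∁x≈⊥)))

  x∧f∁x-isLowerBound : (∀ {x} → F x → IsClosed B f x) →
           ∀ {x y} → F y → _≤_ B (x ∧ f (∁ x)) y
  x∧f∁x-isLowerBound ∈F⇒closed {x} {y} y∈F = ≤-trans (∧-monotoneʳ x f∁x≤∁x∨y) x∧[∁x∨y]≤y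
    where
    f∁x≤∁x∨y : _≤_ B (f (∁ x)) (∁ x ∨ y)
    f∁x≤∁x∨y = f-least (∈F⇒closed (up (y≤x∨y (∁ x) y) y∈F)) (x≤x∨y (∁ x) y)

    x∧[∁x∨y]≤y : _≤_ B (x ∧ (∁ x ∨ y)) y
    x∧[∁x∨y]≤y = ≤-respˡ-≈ (sym (∧-∁∨-cancel x y)) (x∧y≤y x y)

  isPrincipal : (∀ {x} → IsClosed B f x → ¬ x ≈ ⊥ → F x) → (∀ {x} → F x → IsClosed B f x) →
              ∀ {x} → F x → ¬ x ≈ ⊤ → IsPrincipal B F
  isPrincipal closed⇒∈F ∈F⇒closed {x} x∈F x≉⊤ =
    x ∧ f (∁ x) , λ y → mk⇔ (x∧f∁x-isLowerBound ∈F⇒closed) (λ a≤y → up a≤y generator∈F)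
    where
    generator∈F : F (x ∧ f (∁ x))
    generator∈F = meet x∈F (f∁∈F closed⇒∈F x≉⊤)

theorem5p1 : {c ℓ p : Level} (B : BooleanAlgebra c ℓ)
    (f : BooleanAlgebra.Carrier B → BooleanAlgebra.Carrier B)
    (F : BooleanAlgebra.Carrier B → Set p) →
    IsClosureOperator B f → IsFilter B F → NotTrivial B F →
    ClosedSetIs⊥∪ B f F → IsPrincipal B F
theorem5p1 B f F isClosure isFilter (x , x∈F , x≉⊤) closed⇔⊥∪F =
  ClosedFilter.isPrincipal isClosure isFilter closed⇒∈F ∈F⇒closed x∈F x≉⊤
  where
  open BooleanAlgebra B using (_≈_; ⊥)

  closed⇒∈F : ∀ {y} → IsClosed B f y → ¬ y ≈ ⊥ → F y
  closed⇒∈F {y} closed y≉⊥ with Equivalence.to (closed⇔⊥∪F y) closed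
  ... | inj₁ y≈⊥ = contradiction y≈⊥ y≉⊥
  ... | inj₂ y∈F = y∈F

  ∈F⇒closed : ∀ {y} → F y → IsClosed B f y
  ∈F⇒closed {y} y∈F = Equivalence.from (closed⇔⊥∪F y) (inj₂ y∈F)
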